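{- Let $G=(V,E)$ be an undirected graph, $k\ge1$, and $s\in V$. Let $T=\{t\in V\setminus\{s\}: st\notin E,\ \kappa(s,t)\le k\}$ and let $\mathcal{R}_s$ be the family of inclusion-minimal members of $\{R_{st}: t\in T,\ |R_{st}|\le |R_{ts}|\}$. Then $|\mathcal{R}_s|\le 2k+1$.
   Context: $\kappa(x,y)$ is the maximum number of internally disjoint $xy$-paths in $G$. For $A\subseteq V$, $\partial A$ is the set of nodes outside $A$ having a neighbor in $A$, and $A^*=V\setminus(A\cup\partial A)$. $A$ is an $xy$-set if $x\in A$ and $y\in A^*$; $A$ is $xy$-tight if $A$ is an $xy$-set and $|\partial A|=\kappa(x,y)$. For distinct nonadjacent $x,y$, $R_{xy}$ denotes the unique inclusion-minimal $xy$-tight set. -}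

module Defs where

open import Data.Nat using (ℕ; suc; _≤_)
open import Data.Bool using (Bool; true; false; not; _∧_)
open import Data.Fin using (Fin)
open import Data.Fin.Subset using (Subset; _∈_; _∉_; _⊆_; ∣_∣)
open import Data.Vec using (tabulate; lookup)
open import Data.List using (List; []; _∷_; _++_; allFin)
open import Data.Bool.ListAction using (any)
open import Data.List.Relation.Unary.Unique.Propositional using (Unique)
import Data.List.Membership.Propositional as LM
open import Data.Product using (Σ; ∃; _×_)
open import Relation.Binary.PropositionalEquality using (_≡_; _≢_)
open import Relation.Nullary using (¬_)

record Graph (n : ℕ) : Set where
  field
    adj    : Fin n → Fin n → Bool
    sym    : ∀ u v → adj u v ≡ adj v u
    irrefl : ∀ v → adj v v ≡ false
open Graph public

module _ {n : ℕ} (G : Graph n) where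

  Edge : Fin n → Fin n → Set
  Edge u v = adj G u v ≡ true

  data Chain : List (Fin n) → Set where
    chain[]  : Chain []
    chain[-] : ∀ v → Chain (v ∷ [])
    chain∷   : ∀ u v vs → Edge u v → Chain (v ∷ vs) → Chain (u ∷ v ∷ vs)

  IsPath : Fin n → Fin n → List (Fin n) → Set
  IsPath x y inner = Chain (x ∷ inner ++ y ∷ []) × Unique (x ∷ inner ++ y ∷ [])

  HasDisjointPaths : Fin n → Fin n → ℕ → Set
  HasDisjointPaths x y m =
    Σ (Fin m → List (Fin n)) λ P →
      (∀ i → IsPath x y (P i)) ×
      (∀ i j → i ≢ j → (P i ≢ P j) × (∀ v → v LM.∈ P i → ¬ (v LM.∈ P j)))

  IsKappa : Fin n → Fin n → ℕ → Set
  IsKappa x y m = HasDisjointPaths x y m × ¬ HasDisjointPaths x y (suc m)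

  ∂ : Subset n → Subset n
  ∂ A = tabulate λ v → not (lookup A v) ∧ any (λ u → lookup A u ∧ adj G u v) (allFin n)

  _* : Subset n → Subset n
  A * = tabulate λ v → not (lookup A v) ∧ not (lookup (∂ A) v)

  IsXYSet : Fin n → Fin n → Subset n → Set
  IsXYSet x y A = x ∈ A × y ∈ (A *)

  Tight : Fin n → Fin n → Subset n → Set
  Tight x y A = IsXYSet x y A × ∃ λ m → IsKappa x y m × ∣ ∂ A ∣ ≡ m

  -- R is an inclusion-minimal xy-tight set (i.e. R = R_xy; uniqueness is a fact)
  IsR : Fin n → Fin n → Subset n → Set
  IsR x y R = Tight x y R × (∀ A → Tight x y A → A ⊆ R → R ⊆ A)

  InFamily : ℕ → Fin n → Subset n → Set
  InFamily k s R = ∃ λ t →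
    t ≢ s × adj G s t ≡ false × (∃ λ m → IsKappa s t m × m ≤ k) ×
    IsR s t R × (∃ λ R' → IsR t s R' × ∣ R ∣ ≤ ∣ R' ∣)

  InRs : ℕ → Fin n → Subset n → Set
  InRs k s R = InFamily k s R × (∀ R' → InFamily k s R' → R' ⊆ R → R ⊆ R')

-- Members of 𝓡ₛ are least tight sets R_st.  Since |∂·| is submodular and posimodular and
-- κ(x,y) ≤ |∂A| for every xy-set A (the easy half of Menger), tight sets can be uncrossed.
-- Uncrossing shows that for distinct A, B ∈ 𝓡ₛ with targets a, b, the vertex b never lies in
-- A*, and that b ∈ A and a ∈ B cannot both hold, since together they give |A| < |B| (via
-- |R_st| ≤ |R_ts|) and symmetrically |B| < |A|.  So b ∈ ∂A or a ∈ ∂B: the targets span a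
-- semicomplete digraph with out-degrees at most |∂A| ≤ k, and double counting its arcs
-- gives at most 2k + 1 vertices.
module Submission where

open import Defs renaming (sym to adj-sym)
open import Data.Nat using (ℕ; zero; suc; _+_; _*_; _≤_; _<_; z≤n; s≤s; _≤?_)
open import Data.Nat.Properties
  using (≤-refl; ≤-reflexive; ≤-trans; ≤-antisym; <-asym; ≰⇒>;
         +-comm; +-suc; +-identityʳ; *-identityʳ;
         +-mono-≤; +-monoʳ-≤; +-cancelʳ-≤; *-cancelˡ-≤; *-distribˡ-+; m≤m+n; m≤n+m;
         +-0-commutativeMonoid; module ≤-Reasoning)
open import Data.Bool using (Bool; true; false; not; T)
open import Data.Bool.Properties using (T-∧; T-≡)
open import Data.Fin using (Fin; zero; suc; punchIn; inject≤; _≟_)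
open import Data.Fin.Properties using (suc-injective; punchInᵢ≢i; inject≤-injective)
open import Data.Fin.Subset
  using (Subset; inside; outside; _∈_; _∉_; _⊆_; _∩_; _∪_; ⊥; _-_; ∣_∣; Empty)
open import Data.Fin.Subset.Properties
  using (_∈?_; ⊆-antisym; p⊆q⇒∣p∣≤∣q∣; ∣⊥∣≡0; x∈p∪q⁺; x∈p∪q⁻; x∈p∩q⁺; x∈p∩q⁻;
         p∩q⊆p; p∩q⊆q; x∈p∧x≢y⇒x∈p-y; x∈p⇒∣p-x∣<∣p∣)
open import Data.List using (List; []; _∷_; _++_; length; lookup; allFin)
import Data.List.Membership.Propositional as List
open import Data.List.Membership.Propositional.Properties using (∈-allFin; ∈-lookup)
open import Data.List.Relation.Unary.All as All using (All)
open import Data.List.Relation.Unary.AllPairs using (_∷_)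
open import Data.List.Relation.Unary.Any using (here; there; satisfied)
open import Data.List.Relation.Unary.Any.Properties using (any⁺; any⁻)
open import Data.List.Relation.Unary.Unique.Propositional using (Unique)
open import Data.Product using (∃; _×_; _,_; proj₁; proj₂; map₁; map₂)
open import Data.Sum using (_⊎_; inj₁; inj₂; swap)
import Data.Vec as Vec
open import Data.Vec using ([]; _∷_)
open import Data.Vec.Properties using (lookup∘tabulate; []=⇒lookup; lookup⇒[]=)
open import Function using (_∘_; id; Equivalence)
open import Function.Definitions using (Injective)
open import Relation.Binary.PropositionalEquality
open import Relation.Nullary using (Dec; yes; no; ¬_; contradiction)
open import Algebra.Properties.CommutativeMonoid.Sum +-0-commutativeMonoid
  using (sum-syntax; sum-cong-≗; ∑-distrib-+; ∑-comm; sum-remove)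

open Equivalence using (to; from)

𝟙 : {P : Set} → Dec P → ℕ
𝟙 (yes _) = 1
𝟙 (no _)  = 0

𝟙-yes : {P : Set} (p? : Dec P) → P → 𝟙 p? ≡ 1
𝟙-yes (yes _) _ = refl
𝟙-yes (no ¬p) p = contradiction p ¬p

𝟙-mono : {P Q : Set} (p? : Dec P) (q? : Dec Q) → (P → Q) → 𝟙 p? ≤ 𝟙 q?
𝟙-mono (yes _) (yes _) _   = ≤-refl
𝟙-mono (yes p) (no ¬q) p⇒q = contradiction (p⇒q p) ¬q
𝟙-mono (no _)  _       _   = z≤n

∑-mono-≤ : ∀ {n} {f g : Fin n → ℕ} → (∀ i → f i ≤ g i) → ∑[ i < n ] f i ≤ ∑[ i < n ] g i
∑-mono-≤ {zero}  f≤g = z≤n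
∑-mono-≤ {suc n} f≤g = +-mono-≤ (f≤g zero) (∑-mono-≤ (f≤g ∘ suc))

∑-const : ∀ n c → ∑[ i < n ] c ≡ n * c
∑-const zero    c = refl
∑-const (suc n) c = cong (c +_) (∑-const n c)

injective⇒∑𝟙∈≤∣p∣ : ∀ {m n} (f : Fin m → Fin n) → Injective _≡_ _≡_ f → (p : Subset n) →
                     ∑[ i < m ] 𝟙 (f i ∈? p) ≤ ∣ p ∣
injective⇒∑𝟙∈≤∣p∣ {zero}  f f-inj p = z≤n
injective⇒∑𝟙∈≤∣p∣ {suc m} f f-inj p with f zero ∈? p
... | no  _    = injective⇒∑𝟙∈≤∣p∣ (f ∘ suc) (suc-injective ∘ f-inj) p
... | yes f₀∈p = begin
  suc (∑[ i < m ] 𝟙 (f (suc i) ∈? p))           ≤⟨ s≤s (∑-mono-≤ λ i → 𝟙-mono _ _ (λ fᵢ∈p →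
                                                      x∈p∧x≢y⇒x∈p-y fᵢ∈p (distinct i))) ⟩
  suc (∑[ i < m ] 𝟙 (f (suc i) ∈? p - f zero))  ≤⟨ s≤s (injective⇒∑𝟙∈≤∣p∣ (f ∘ suc)
                                                      (suc-injective ∘ f-inj) (p - f zero)) ⟩
  suc ∣ p - f zero ∣                             ≤⟨ x∈p⇒∣p-x∣<∣p∣ f₀∈p ⟩
  ∣ p ∣                                          ∎
  where
  open ≤-Reasoning
  distinct : ∀ i → f (suc i) ≢ f zero
  distinct i e with f-inj e
  ... | ()

injective⇒≤∣p∣ : ∀ {m n} (f : Fin m → Fin n) → Injective _≡_ _≡_ f → (p : Subset n) →
                 (∀ i → f i ∈ p) → m ≤ ∣ p ∣
injective⇒≤∣p∣ {m} f f-inj p f∈p = begin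
  m                         ≡⟨ trans (sym (*-identityʳ m)) (sym (∑-const m 1)) ⟩
  ∑[ i < m ] 1              ≡⟨ sum-cong-≗ (λ i → sym (𝟙-yes (f i ∈? p) (f∈p i))) ⟩
  ∑[ i < m ] 𝟙 (f i ∈? p)   ≤⟨ injective⇒∑𝟙∈≤∣p∣ f f-inj p ⟩
  ∣ p ∣                     ∎
  where open ≤-Reasoning

-- Each vertex meets the other p − 1 in at least one arc each, so p(p − 1) ≤ ∑ᵢ∑ⱼ (arcs i j),
-- which is twice the number of arcs, hence at most 2pk.
semicomplete⇒≤2k+1 : ∀ {p} k (E : Fin p → Fin p → Set) (E? : ∀ i j → Dec (E i j)) →
                      (∀ {i j} → i ≢ j → E i j ⊎ E j i) →
                      (∀ i → ∑[ j < p ] 𝟙 (E? i j) ≤ k) →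
                      p ≤ 2 * k + 1
semicomplete⇒≤2k+1 {zero}  k E E? total outdeg = z≤n
semicomplete⇒≤2k+1 {suc q} k E E? total outdeg = begin
  suc q        ≤⟨ s≤s (*-cancelˡ-≤ (suc q) (≤-trans pairs≥ pairs≤)) ⟩
  suc (2 * k)  ≡⟨ +-comm 1 (2 * k) ⟩
  2 * k + 1    ∎
  where
  open ≤-Reasoning
  p = suc q
  arcs : Fin p → Fin p → ℕ
  arcs i j = 𝟙 (E? i j) + 𝟙 (E? j i)
  out : Fin p → ℕ
  out i = ∑[ j < p ] 𝟙 (E? i j)

  1≤arcs : ∀ {i j} → i ≢ j → 1 ≤ arcs i j
  1≤arcs {i} {j} i≢j with total i≢j
  ... | inj₁ eij = subst (_≤ arcs i j) (𝟙-yes (E? i j) eij) (m≤m+n _ _)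
  ... | inj₂ eji = subst (_≤ arcs i j) (𝟙-yes (E? j i) eji) (m≤n+m _ _)

  q≤arcs-at : ∀ i → q ≤ ∑[ j < p ] arcs i j
  q≤arcs-at i = begin
    q                                           ≡⟨ trans (sym (*-identityʳ q)) (sym (∑-const q 1)) ⟩
    ∑[ j < q ] 1                                ≤⟨ ∑-mono-≤ (λ j → 1≤arcs (punchInᵢ≢i i j ∘ sym)) ⟩
    ∑[ j < q ] arcs i (punchIn i j)             ≤⟨ m≤n+m _ _ ⟩
    arcs i i + ∑[ j < q ] arcs i (punchIn i j)  ≡⟨ sym (sum-remove (arcs i)) ⟩
    ∑[ j < p ] arcs i j                         ∎

  pairs≥ : p * q ≤ ∑[ i < p ] ∑[ j < p ] arcs i j
  pairs≥ = begin
    p * q                           ≡⟨ sym (∑-const p q) ⟩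
    ∑[ i < p ] q                    ≤⟨ ∑-mono-≤ q≤arcs-at ⟩
    ∑[ i < p ] ∑[ j < p ] arcs i j  ∎

  pairs≤ : ∑[ i < p ] ∑[ j < p ] arcs i j ≤ p * (2 * k)
  pairs≤ = begin
    ∑[ i < p ] ∑[ j < p ] arcs i j
      ≡⟨ sum-cong-≗ (λ i → ∑-distrib-+ (λ j → 𝟙 (E? i j)) (λ j → 𝟙 (E? j i))) ⟩
    ∑[ i < p ] (out i + ∑[ j < p ] 𝟙 (E? j i))
      ≡⟨ ∑-distrib-+ out (λ i → ∑[ j < p ] 𝟙 (E? j i)) ⟩
    ∑[ i < p ] out i + ∑[ i < p ] ∑[ j < p ] 𝟙 (E? j i)
      ≡⟨ cong (∑[ i < p ] out i +_) (∑-comm (λ i j → 𝟙 (E? j i))) ⟩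
    ∑[ i < p ] out i + ∑[ j < p ] out j
      ≤⟨ +-mono-≤ (∑-mono-≤ outdeg) (∑-mono-≤ outdeg) ⟩
    ∑[ i < p ] k + ∑[ i < p ] k
      ≡⟨ cong₂ _+_ (∑-const p k) (∑-const p k) ⟩
    p * k + p * k
      ≡⟨ cong (λ z → p * k + p * z) (sym (+-identityʳ k)) ⟩
    p * k + p * (k + 0)
      ≡⟨ sym (*-distribˡ-+ p k (k + 0)) ⟩
    p * (2 * k) ∎

∣p∪q∣+∣p∩q∣≡∣p∣+∣q∣ : ∀ {n} (p q : Subset n) → ∣ p ∪ q ∣ + ∣ p ∩ q ∣ ≡ ∣ p ∣ + ∣ q ∣
∣p∪q∣+∣p∩q∣≡∣p∣+∣q∣ []            []            = refl
∣p∪q∣+∣p∩q∣≡∣p∣+∣q∣ (inside  ∷ p) (inside  ∷ q) =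
  cong suc (trans (+-suc _ _) (trans (cong suc (∣p∪q∣+∣p∩q∣≡∣p∣+∣q∣ p q)) (sym (+-suc _ _))))
∣p∪q∣+∣p∩q∣≡∣p∣+∣q∣ (inside  ∷ p) (outside ∷ q) = cong suc (∣p∪q∣+∣p∩q∣≡∣p∣+∣q∣ p q)
∣p∪q∣+∣p∩q∣≡∣p∣+∣q∣ (outside ∷ p) (inside  ∷ q) =
  trans (cong suc (∣p∪q∣+∣p∩q∣≡∣p∣+∣q∣ p q)) (sym (+-suc _ _))
∣p∪q∣+∣p∩q∣≡∣p∣+∣q∣ (outside ∷ p) (outside ∷ q) = ∣p∪q∣+∣p∩q∣≡∣p∣+∣q∣ p q

∩⊆∩∧∪⊆∪⇒∣p∣+∣q∣≤∣r∣+∣s∣ : ∀ {n} {p q r s : Subset n} → p ∩ q ⊆ r ∩ s → p ∪ q ⊆ r ∪ s →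
                           ∣ p ∣ + ∣ q ∣ ≤ ∣ r ∣ + ∣ s ∣
∩⊆∩∧∪⊆∪⇒∣p∣+∣q∣≤∣r∣+∣s∣ {p = p} {q} {r} {s} ∩⊆ ∪⊆ = begin
  ∣ p ∣ + ∣ q ∣              ≡⟨ sym (∣p∪q∣+∣p∩q∣≡∣p∣+∣q∣ p q) ⟩
  ∣ p ∪ q ∣ + ∣ p ∩ q ∣      ≤⟨ +-mono-≤ (p⊆q⇒∣p∣≤∣q∣ ∪⊆) (p⊆q⇒∣p∣≤∣q∣ ∩⊆) ⟩
  ∣ r ∪ s ∣ + ∣ r ∩ s ∣      ≡⟨ ∣p∪q∣+∣p∩q∣≡∣p∣+∣q∣ r s ⟩
  ∣ r ∣ + ∣ s ∣              ∎
  where open ≤-Reasoning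

disjoint⇒∣p∣+∣q∣≤∣r∣ : ∀ {n} {p q r : Subset n} → p ⊆ r → q ⊆ r → Empty (p ∩ q) →
                       ∣ p ∣ + ∣ q ∣ ≤ ∣ r ∣
disjoint⇒∣p∣+∣q∣≤∣r∣ {n} {p} {q} {r} p⊆r q⊆r p∩q=∅ = begin
  ∣ p ∣ + ∣ q ∣          ≤⟨ ∩⊆∩∧∪⊆∪⇒∣p∣+∣q∣≤∣r∣+∣s∣ (λ x∈p∩q → contradiction (_ , x∈p∩q) p∩q=∅) ∪⊆ ⟩
  ∣ r ∣ + ∣ ⊥ {n = n} ∣  ≡⟨ trans (cong (∣ r ∣ +_) (∣⊥∣≡0 n)) (+-identityʳ _) ⟩
  ∣ r ∣                  ∎
  where
  open ≤-Reasoning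
  ∪⊆ : p ∪ q ⊆ r ∪ ⊥ {n = n}
  ∪⊆ x∈p∪q with x∈p∪q⁻ p q x∈p∪q
  ... | inj₁ x∈p = x∈p∪q⁺ (inj₁ (p⊆r x∈p))
  ... | inj₂ x∈q = x∈p∪q⁺ (inj₁ (q⊆r x∈q))

Unique⇒lookup-injective : ∀ {A : Set} {xs : List A} → Unique xs →
                          ∀ {i j} → i ≢ j → lookup xs i ≢ lookup xs j
Unique⇒lookup-injective (_ ∷ _)     {zero}  {zero}  i≢j = contradiction refl i≢j
Unique⇒lookup-injective (x∉xs ∷ _)  {zero}  {suc j} _   = All.lookup x∉xs (∈-lookup j)
Unique⇒lookup-injective (x∉xs ∷ _)  {suc i} {zero}  _   = All.lookup x∉xs (∈-lookup i) ∘ sym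
Unique⇒lookup-injective (_ ∷ unique) {suc i} {suc j} i≢j =
  Unique⇒lookup-injective unique (i≢j ∘ cong suc)

module _ {n : ℕ} where

  ∈⇒T : ∀ {v} {p : Subset n} → v ∈ p → T (Vec.lookup p v)
  ∈⇒T v∈p = from T-≡ ([]=⇒lookup v∈p)

  T⇒∈ : ∀ {v} {p : Subset n} → T (Vec.lookup p v) → v ∈ p
  T⇒∈ = lookup⇒[]= _ _ ∘ to T-≡

  ∈-tabulate⁻ : ∀ {v} (f : Fin n → Bool) → v ∈ Vec.tabulate f → T (f v)
  ∈-tabulate⁻ {v} f v∈ = subst T (lookup∘tabulate f v) (∈⇒T v∈)

  ∈-tabulate⁺ : ∀ {v} (f : Fin n → Bool) → T (f v) → v ∈ Vec.tabulate f
  ∈-tabulate⁺ {v} f t = T⇒∈ (subst T (sym (lookup∘tabulate f v)) t)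

  ∉⇒T-not : ∀ {v} {p : Subset n} → v ∉ p → T (not (Vec.lookup p v))
  ∉⇒T-not v∉p = ¬T⇒T-not (v∉p ∘ T⇒∈)
    where
    ¬T⇒T-not : ∀ {b} → ¬ T b → T (not b)
    ¬T⇒T-not {true}  ¬t = ¬t _
    ¬T⇒T-not {false} _  = _

  T-not⇒∉ : ∀ {v} {p : Subset n} → T (not (Vec.lookup p v)) → v ∉ p
  T-not⇒∉ t = T-not⇒¬T t ∘ ∈⇒T
    where
    T-not⇒¬T : ∀ {b} → T (not b) → ¬ T b
    T-not⇒¬T {false} _ ()

module _ {n : ℕ} (G : Graph n) where

  private
    variable
      A B C R : Subset n
      u v x y y′ : Fin n
      m m′ : ℕ

  -- The far side A* of A, renamed since `A *` would parse as a section of ℕ's _*_.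
  infix 10 _⋆
  _⋆ : Subset n → Subset n
  A ⋆ = Defs._* G A

  ∈∂⁺ : u ∈ A → Edge G u v → v ∉ A → v ∈ ∂ G A
  ∈∂⁺ {u = u} u∈A e v∉A = ∈-tabulate⁺ _ (from T-∧ (∉⇒T-not v∉A ,
    any⁺ _ (List.lose (∈-allFin u) (from T-∧ (∈⇒T u∈A , from T-≡ e)))))

  ∈∂⁻ : ∀ A → v ∈ ∂ G A → v ∉ A × ∃ λ u → u ∈ A × Edge G u v
  ∈∂⁻ _ v∈∂A with to T-∧ (∈-tabulate⁻ _ v∈∂A)
  ... | v∉A , adjacent with satisfied (any⁻ _ (allFin n) adjacent)
  ...   | u , u∈A∧e with to T-∧ u∈A∧e
  ...     | u∈A , e = T-not⇒∉ v∉A , u , T⇒∈ u∈A , to T-≡ e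

  ∈⋆⁺ : v ∉ A → v ∉ ∂ G A → v ∈ A ⋆
  ∈⋆⁺ v∉A v∉∂A = ∈-tabulate⁺ _ (from T-∧ (∉⇒T-not v∉A , ∉⇒T-not v∉∂A))

  ∈⋆⁻ : ∀ A → v ∈ A ⋆ → v ∉ A × v ∉ ∂ G A
  ∈⋆⁻ _ v∈A⋆ with to T-∧ (∈-tabulate⁻ _ v∈A⋆)
  ... | v∉A , v∉∂A = T-not⇒∉ v∉A , T-not⇒∉ v∉∂A

  Edge-sym : Edge G u v → Edge G v u
  Edge-sym {u} {v} e = trans (adj-sym G v u) e

  ⋆-no-edge : u ∈ A → v ∈ A ⋆ → ¬ Edge G u v
  ⋆-no-edge {A = A} u∈A v∈A⋆ e = proj₂ (∈⋆⁻ A v∈A⋆) (∈∂⁺ u∈A e (proj₁ (∈⋆⁻ A v∈A⋆)))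

  ∈∂-⊆ : C ⊆ A → v ∈ ∂ G C → v ∉ A → v ∈ ∂ G A
  ∈∂-⊆ {C = C} C⊆A v∈∂C v∉A with ∈∂⁻ C v∈∂C
  ... | _ , u , u∈C , e = ∈∂⁺ (C⊆A u∈C) e v∉A

  ∈∂⇒∉ : C ⊆ A ⋆ → v ∈ ∂ G C → v ∉ A
  ∈∂⇒∉ {C = C} C⊆A⋆ v∈∂C v∈A with ∈∂⁻ C v∈∂C
  ... | _ , u , u∈C , e = ⋆-no-edge v∈A (C⊆A⋆ u∈C) (Edge-sym e)

  ∉⋆⇒∈⊎∈∂ : ∀ A → v ∉ A ⋆ → v ∈ A ⊎ v ∈ ∂ G A
  ∉⋆⇒∈⊎∈∂ {v} A v∉A⋆ with v ∈? A | v ∈? ∂ G A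
  ... | yes v∈A | _        = inj₁ v∈A
  ... | no  _   | yes v∈∂A = inj₂ v∈∂A
  ... | no  v∉A | no v∉∂A  = contradiction (∈⋆⁺ v∉A v∉∂A) v∉A⋆

  ⋆-antitone : A ⊆ B → B ⋆ ⊆ A ⋆
  ⋆-antitone {B = B} A⊆B v∈B⋆ with ∈⋆⁻ B v∈B⋆
  ... | v∉B , v∉∂B = ∈⋆⁺ (v∉B ∘ A⊆B) (λ v∈∂A → v∉∂B (∈∂-⊆ A⊆B v∈∂A v∉B))

  ⋆-∪ : v ∈ A ⋆ → v ∈ B ⋆ → v ∈ (A ∪ B) ⋆
  ⋆-∪ {v} {A} {B} v∈A⋆ v∈B⋆ = ∈⋆⁺ v∉A∪B v∉∂A∪B
    where
    v∉A∪B : v ∉ A ∪ B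
    v∉A∪B v∈A∪B with x∈p∪q⁻ A B v∈A∪B
    ... | inj₁ v∈A = proj₁ (∈⋆⁻ A v∈A⋆) v∈A
    ... | inj₂ v∈B = proj₁ (∈⋆⁻ B v∈B⋆) v∈B
    v∉∂A∪B : v ∉ ∂ G (A ∪ B)
    v∉∂A∪B v∈∂A∪B with ∈∂⁻ (A ∪ B) v∈∂A∪B
    ... | _ , u , u∈A∪B , e with x∈p∪q⁻ A B u∈A∪B
    ...   | inj₁ u∈A = ⋆-no-edge u∈A v∈A⋆ e
    ...   | inj₂ u∈B = ⋆-no-edge u∈B v∈B⋆ e

  ⊆⋆⋆ : A ⊆ A ⋆ ⋆
  ⊆⋆⋆ {A = A} v∈A =
    ∈⋆⁺ (λ v∈A⋆ → proj₁ (∈⋆⁻ A v∈A⋆) v∈A) (λ v∈∂A⋆ → ∈∂⇒∉ {C = A ⋆} id v∈∂A⋆ v∈A)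

  ∂⋆⊆∂ : ∂ G (A ⋆) ⊆ ∂ G A
  ∂⋆⊆∂ {A = A} v∈∂A⋆ with ∉⋆⇒∈⊎∈∂ A (proj₁ (∈∂⁻ (A ⋆) v∈∂A⋆))
  ... | inj₁ v∈A  = contradiction v∈A (∈∂⇒∉ {C = A ⋆} id v∈∂A⋆)
  ... | inj₂ v∈∂A = v∈∂A

  ∂-submodular : ∀ A B → ∣ ∂ G (A ∩ B) ∣ + ∣ ∂ G (A ∪ B) ∣ ≤ ∣ ∂ G A ∣ + ∣ ∂ G B ∣
  ∂-submodular A B = ∩⊆∩∧∪⊆∪⇒∣p∣+∣q∣≤∣r∣+∣s∣ ∩⊆∩ ∪⊆∪
    where
    ∉∪ : v ∉ A ∪ B → v ∉ A × v ∉ B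
    ∉∪ v∉A∪B = v∉A∪B ∘ x∈p∪q⁺ ∘ inj₁ , v∉A∪B ∘ x∈p∪q⁺ ∘ inj₂
    ∩⊆∩ : ∂ G (A ∩ B) ∩ ∂ G (A ∪ B) ⊆ ∂ G A ∩ ∂ G B
    ∩⊆∩ v∈ with x∈p∩q⁻ (∂ G (A ∩ B)) (∂ G (A ∪ B)) v∈
    ... | v∈∂A∩B , v∈∂A∪B with ∉∪ (proj₁ (∈∂⁻ (A ∪ B) v∈∂A∪B))
    ...   | v∉A , v∉B = x∈p∩q⁺ (∈∂-⊆ (p∩q⊆p A B) v∈∂A∩B v∉A , ∈∂-⊆ (p∩q⊆q A B) v∈∂A∩B v∉B)
    ∪⊆∪ : ∂ G (A ∩ B) ∪ ∂ G (A ∪ B) ⊆ ∂ G A ∪ ∂ G B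
    ∪⊆∪ {v} v∈ with x∈p∪q⁻ (∂ G (A ∩ B)) (∂ G (A ∪ B)) v∈
    ... | inj₁ v∈∂A∩B with v ∈? A
    ...   | no  v∉A = x∈p∪q⁺ (inj₁ (∈∂-⊆ (p∩q⊆p A B) v∈∂A∩B v∉A))
    ...   | yes v∈A = x∈p∪q⁺ (inj₂ (∈∂-⊆ (p∩q⊆q A B) v∈∂A∩B
                        (λ v∈B → proj₁ (∈∂⁻ (A ∩ B) v∈∂A∩B) (x∈p∩q⁺ (v∈A , v∈B)))))
    ∪⊆∪ v∈ | inj₂ v∈∂A∪B with ∈∂⁻ (A ∪ B) v∈∂A∪B
    ... | v∉A∪B , u , u∈A∪B , e with x∈p∪q⁻ A B u∈A∪B
    ...   | inj₁ u∈A = x∈p∪q⁺ (inj₁ (∈∂⁺ u∈A e (proj₁ (∉∪ v∉A∪B))))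
    ...   | inj₂ u∈B = x∈p∪q⁺ (inj₂ (∈∂⁺ u∈B e (proj₂ (∉∪ v∉A∪B))))

  ∂-posimodular : ∀ A B → ∣ ∂ G (A ∩ B ⋆) ∣ + ∣ ∂ G (B ∩ A ⋆) ∣ ≤ ∣ ∂ G A ∣ + ∣ ∂ G B ∣
  ∂-posimodular A B = ∩⊆∩∧∪⊆∪⇒∣p∣+∣q∣≤∣r∣+∣s∣ ∩⊆∩ ∪⊆∪
    where
    ∂∩⋆⊆∂∪∂ : ∀ A B → ∂ G (A ∩ B ⋆) ⊆ ∂ G A ∪ ∂ G B
    ∂∩⋆⊆∂∪∂ A B {v} v∈ with v ∈? A
    ... | no  v∉A = x∈p∪q⁺ (inj₁ (∈∂-⊆ (p∩q⊆p A (B ⋆)) v∈ v∉A))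
    ... | yes v∈A with ∉⋆⇒∈⊎∈∂ B (λ v∈B⋆ → proj₁ (∈∂⁻ (A ∩ B ⋆) v∈) (x∈p∩q⁺ (v∈A , v∈B⋆)))
    ...   | inj₁ v∈B  = contradiction v∈B (∈∂⇒∉ (p∩q⊆q A (B ⋆)) v∈)
    ...   | inj₂ v∈∂B = x∈p∪q⁺ (inj₂ v∈∂B)
    ∩⊆∩ : ∂ G (A ∩ B ⋆) ∩ ∂ G (B ∩ A ⋆) ⊆ ∂ G A ∩ ∂ G B
    ∩⊆∩ v∈ with x∈p∩q⁻ (∂ G (A ∩ B ⋆)) (∂ G (B ∩ A ⋆)) v∈
    ... | v∈∂₁ , v∈∂₂ =
      x∈p∩q⁺ (∈∂-⊆ (p∩q⊆p A (B ⋆)) v∈∂₁ (∈∂⇒∉ (p∩q⊆q B (A ⋆)) v∈∂₂) ,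
              ∈∂-⊆ (p∩q⊆p B (A ⋆)) v∈∂₂ (∈∂⇒∉ (p∩q⊆q A (B ⋆)) v∈∂₁))
    ∪⊆∪ : ∂ G (A ∩ B ⋆) ∪ ∂ G (B ∩ A ⋆) ⊆ ∂ G A ∪ ∂ G B
    ∪⊆∪ v∈ with x∈p∪q⁻ (∂ G (A ∩ B ⋆)) (∂ G (B ∩ A ⋆)) v∈
    ... | inj₁ v∈∂₁ = ∂∩⋆⊆∂∪∂ A B v∈∂₁
    ... | inj₂ v∈∂₂ = x∈p∪q⁺ (swap (x∈p∪q⁻ (∂ G B) (∂ G A) (∂∩⋆⊆∂∪∂ B A v∈∂₂)))

  path-meets-∂ : ∀ {u} inner → u ∈ A → y ∈ A ⋆ → Chain G (u ∷ inner ++ y ∷ []) →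
                 ∃ λ v → v List.∈ inner × v ∈ ∂ G A
  path-meets-∂ []       u∈A y∈A⋆ (chain∷ _ _ _ e _) = contradiction e (⋆-no-edge u∈A y∈A⋆)
  path-meets-∂ {A = A} (w ∷ ws) u∈A y∈A⋆ (chain∷ _ _ _ e c) with w ∈? A
  ... | yes w∈A = map₂ (map₁ there) (path-meets-∂ ws w∈A y∈A⋆ c)
  ... | no  w∉A = w , here refl , ∈∂⁺ u∈A e w∉A

  disjoint-paths≤∣∂∣ : HasDisjointPaths G x y m → x ∈ A → y ∈ A ⋆ → m ≤ ∣ ∂ G A ∣
  disjoint-paths≤∣∂∣ {A = A} (P , paths , disjoint) x∈A y∈A⋆ =
    injective⇒≤∣p∣ exit exit-injective (∂ G A) (proj₂ ∘ proj₂ ∘ meet)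
    where
    meet = λ i → path-meets-∂ (P i) x∈A y∈A⋆ (proj₁ (paths i))
    exit = λ i → proj₁ (meet i)
    exit-injective : ∀ {i j} → exit i ≡ exit j → i ≡ j
    exit-injective {i} {j} eq with i ≟ j
    ... | yes i≡j = i≡j
    ... | no  i≢j = contradiction (subst (List._∈ P j) (sym eq) (proj₁ (proj₂ (meet j))))
                                  (proj₂ (disjoint i j i≢j) (exit i) (proj₁ (proj₂ (meet i))))

  HasDisjointPaths-≤ : m ≤ m′ → HasDisjointPaths G x y m′ → HasDisjointPaths G x y m
  HasDisjointPaths-≤ m≤m′ (P , paths , disjoint) =
    P ∘ embed , paths ∘ embed ,
    λ i j i≢j → disjoint (embed i) (embed j) (i≢j ∘ inject≤-injective m≤m′ m≤m′ i j)
    where embed = λ i → inject≤ i m≤m′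

  κ-maximal : IsKappa G x y m → HasDisjointPaths G x y m′ → m′ ≤ m
  κ-maximal {m = m} {m′ = m′} (_ , no-more) paths with m′ ≤? m
  ... | yes m′≤m = m′≤m
  ... | no  m′≰m = contradiction (HasDisjointPaths-≤ (≰⇒> m′≰m) paths) no-more

  tight-∂≤ : Tight G x y A → IsXYSet G x y C → ∣ ∂ G A ∣ ≤ ∣ ∂ G C ∣
  tight-∂≤ (_ , _ , (paths , _) , ∣∂A∣≡m) (x∈C , y∈C⋆) =
    subst (_≤ _) (sym ∣∂A∣≡m) (disjoint-paths≤∣∂∣ paths x∈C y∈C⋆)

  IsXYSet-⋆ : IsXYSet G y x C → IsXYSet G x y (C ⋆)
  IsXYSet-⋆ (y∈C , x∈C⋆) = x∈C⋆ , ⊆⋆⋆ y∈C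

  tight-∂≤ʳ : Tight G x y A → IsXYSet G y x C → ∣ ∂ G A ∣ ≤ ∣ ∂ G C ∣
  tight-∂≤ʳ {C = C} tight yx-set =
    ≤-trans (tight-∂≤ tight (IsXYSet-⋆ yx-set)) (p⊆q⇒∣p∣≤∣q∣ (∂⋆⊆∂ {A = C}))

  tight-if-∂≤ : Tight G x y A → IsXYSet G x y C → ∣ ∂ G C ∣ ≤ ∣ ∂ G A ∣ → Tight G x y C
  tight-if-∂≤ tight@(_ , m , κ , ∣∂A∣≡m) xy-set ∂C≤∂A =
    xy-set , m , κ , trans (≤-antisym ∂C≤∂A (tight-∂≤ tight xy-set)) ∣∂A∣≡m

  ∂-∩≤ : Tight G x y′ B → y′ ∈ A ⋆ → ∣ ∂ G (A ∩ B) ∣ ≤ ∣ ∂ G A ∣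
  ∂-∩≤ {x = x} {y′ = y′} {B = B} {A = A} tight@((x∈B , y′∈B⋆) , _) y′∈A⋆ =
    +-cancelʳ-≤ ∣ ∂ G B ∣ _ _ (begin
    ∣ ∂ G (A ∩ B) ∣ + ∣ ∂ G B ∣        ≤⟨ +-monoʳ-≤ _ (tight-∂≤ tight A∪B-is-xy′-set) ⟩
    ∣ ∂ G (A ∩ B) ∣ + ∣ ∂ G (A ∪ B) ∣  ≤⟨ ∂-submodular A B ⟩
    ∣ ∂ G A ∣ + ∣ ∂ G B ∣              ∎)
    where
    open ≤-Reasoning
    A∪B-is-xy′-set : IsXYSet G x y′ (A ∪ B)
    A∪B-is-xy′-set = x∈p∪q⁺ (inj₂ x∈B) , ⋆-∪ {A = A} {B = B} y′∈A⋆ y′∈B⋆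

  ∂-∩⋆≤ : Tight G x y′ B → y′ ∈ A → ∣ ∂ G (B ∩ A ⋆) ∣ ≤ ∣ ∂ G A ∣
  ∂-∩⋆≤ {x = x} {y′ = y′} {B = B} {A = A} tight@((x∈B , y′∈B⋆) , _) y′∈A =
    +-cancelʳ-≤ ∣ ∂ G B ∣ _ _ (begin
    ∣ ∂ G (B ∩ A ⋆) ∣ + ∣ ∂ G B ∣          ≤⟨ +-monoʳ-≤ _ (tight-∂≤ʳ tight (y′∈A∩B⋆ , x∈[A∩B⋆]⋆)) ⟩
    ∣ ∂ G (B ∩ A ⋆) ∣ + ∣ ∂ G (A ∩ B ⋆) ∣  ≤⟨ ∂-posimodular B A ⟩
    ∣ ∂ G B ∣ + ∣ ∂ G A ∣                  ≡⟨ +-comm ∣ ∂ G B ∣ ∣ ∂ G A ∣ ⟩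
    ∣ ∂ G A ∣ + ∣ ∂ G B ∣                  ∎)
    where
    open ≤-Reasoning
    y′∈A∩B⋆ : y′ ∈ A ∩ B ⋆
    y′∈A∩B⋆ = x∈p∩q⁺ (y′∈A , y′∈B⋆)
    x∈[A∩B⋆]⋆ : x ∈ (A ∩ B ⋆) ⋆
    x∈[A∩B⋆]⋆ = ⋆-antitone (p∩q⊆q A (B ⋆)) (⊆⋆⋆ x∈B)

  tight-∩ : Tight G x y A → Tight G x y′ B → y′ ∈ A ⋆ → Tight G x y (A ∩ B)
  tight-∩ {A = A} {B = B} tightA@((x∈A , y∈A⋆) , _) tightB@((x∈B , _) , _) y′∈A⋆ =
    tight-if-∂≤ tightA (x∈p∩q⁺ (x∈A , x∈B) , ⋆-antitone (p∩q⊆p A B) y∈A⋆)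
                (∂-∩≤ {A = A} tightB y′∈A⋆)

  R-least : IsR G x y R → Tight G x y C → R ⊆ C
  R-least {R = R} {C = C} (tightR@((_ , y∈R⋆) , _) , minimal) tightC v∈R =
    p∩q⊆q R C (minimal (R ∩ C) (tight-∩ tightR tightC y∈R⋆) (p∩q⊆p R C) v∈R)

  module _ (k : ℕ) (s : Fin n) where

    target : InRs G k s A → Fin n
    target ((t , _) , _) = t

    target-R : (a : InRs G k s A) → IsR G s (target a) A
    target-R ((_ , _ , _ , _ , R , _) , _) = R

    target-tight : (a : InRs G k s A) → Tight G s (target a) A
    target-tight = proj₁ ∘ target-R

    target-far : (a : InRs G k s A) → target a ∈ A ⋆
    target-far = proj₂ ∘ proj₁ ∘ target-tight

    ∣∂∣≤k : InRs G k s A → ∣ ∂ G A ∣ ≤ k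
    ∣∂∣≤k ((_ , _ , _ , (_ , κ , κ≤k) , ((_ , _ , κ′ , ∣∂A∣≡κ′) , _) , _) , _) =
      ≤-trans (≤-reflexive ∣∂A∣≡κ′) (≤-trans (κ-maximal κ (proj₁ κ′)) κ≤k)

    target-not-far : (a : InRs G k s A) (b : InRs G k s B) → A ≢ B → target b ∉ A ⋆
    target-not-far {A = A} {B = B} a b@(_ , B-minimal) A≢B tb∈A⋆ =
      A≢B (⊆-antisym A⊆B (B-minimal A (proj₁ a) A⊆B))
      where
      A∩B-tight : Tight G s (target a) (A ∩ B)
      A∩B-tight = tight-∩ (target-tight a) (target-tight b) tb∈A⋆
      A⊆B : A ⊆ B
      A⊆B v∈A = p∩q⊆q A B (proj₂ (target-R a) (A ∩ B) A∩B-tight (p∩q⊆p A B) v∈A)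

    targets-distinct : (a : InRs G k s A) (b : InRs G k s B) → A ≢ B → target a ≢ target b
    targets-distinct a b A≢B ta≡tb = target-not-far a b A≢B (subst (_∈ _) ta≡tb (target-far a))

    cross-contained⇒∣A∣<∣B∣ : (a : InRs G k s A) (b : InRs G k s B) →
                              target b ∈ A → target a ∈ B → ∣ A ∣ < ∣ B ∣
    cross-contained⇒∣A∣<∣B∣ {A = A} {B = B}
      a@((_ , _ , _ , _ , _ , R′ , R′-is-R , ∣A∣≤∣R′∣) , _) b tb∈A ta∈B = begin
        suc ∣ A ∣                  ≤⟨ s≤s ∣A∣≤∣R′∣ ⟩
        suc ∣ R′ ∣                 ≤⟨ s≤s (p⊆q⇒∣p∣≤∣q∣ (R-least R′-is-R D-tight)) ⟩
        suc ∣ D ∣                  ≡⟨ +-comm 1 ∣ D ∣ ⟩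
        ∣ D ∣ + 1                  ≤⟨ +-monoʳ-≤ ∣ D ∣ 1≤∣A∩B∣ ⟩
        ∣ D ∣ + ∣ A ∩ B ∣          ≤⟨ disjoint⇒∣p∣+∣q∣≤∣r∣ (p∩q⊆p B (A ⋆)) (p∩q⊆q A B) D∩A∩B=∅ ⟩
        ∣ B ∣                      ∎
      where
      open ≤-Reasoning
      D : Subset n
      D = B ∩ A ⋆
      s∈A : s ∈ A
      s∈A = proj₁ (proj₁ (target-tight a))
      s∈D⋆ : s ∈ D ⋆
      s∈D⋆ = ⋆-antitone (p∩q⊆q B (A ⋆)) (⊆⋆⋆ s∈A)
      D-tight : Tight G (target a) s D
      D-tight = tight-if-∂≤ (proj₁ R′-is-R) (x∈p∩q⁺ (ta∈B , target-far a) , s∈D⋆)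
        (≤-trans (∂-∩⋆≤ (target-tight b) tb∈A)
                 (tight-∂≤ʳ (target-tight a) (proj₁ (proj₁ R′-is-R))))
      1≤∣A∩B∣ : 1 ≤ ∣ A ∩ B ∣
      1≤∣A∩B∣ = ≤-trans (s≤s z≤n) (x∈p⇒∣p-x∣<∣p∣ (x∈p∩q⁺ (s∈A , proj₁ (proj₁ (target-tight b)))))
      D∩A∩B=∅ : Empty (D ∩ (A ∩ B))
      D∩A∩B=∅ (v , v∈D∩A∩B) with x∈p∩q⁻ D (A ∩ B) v∈D∩A∩B
      ... | v∈D , v∈A∩B = proj₁ (∈⋆⁻ A (p∩q⊆q B (A ⋆) v∈D)) (p∩q⊆p A B v∈A∩B)

    target∈∂⊎target∈∂ : (a : InRs G k s A) (b : InRs G k s B) → A ≢ B →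
                        target b ∈ ∂ G A ⊎ target a ∈ ∂ G B
    target∈∂⊎target∈∂ {A = A} {B = B} a b A≢B
      with ∉⋆⇒∈⊎∈∂ A (target-not-far a b A≢B) | ∉⋆⇒∈⊎∈∂ B (target-not-far b a (A≢B ∘ sym))
    ... | inj₂ tb∈∂A | _          = inj₁ tb∈∂A
    ... | inj₁ _     | inj₂ ta∈∂B = inj₂ ta∈∂B
    ... | inj₁ tb∈A  | inj₁ ta∈B  =
      contradiction (cross-contained⇒∣A∣<∣B∣ b a ta∈B tb∈A)
                    (<-asym (cross-contained⇒∣A∣<∣B∣ a b tb∈A ta∈B))

lemma6 : (n : ℕ) (G : Graph n) (k : ℕ) → 1 ≤ k → (s : Fin n) →
         (L : List (Subset n)) → Unique L → All (InRs G k s) L →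
         length L ≤ 2 * k + 1
lemma6 n G k _ s L unique members =
  semicomplete⇒≤2k+1 k (λ i j → t j ∈ ∂ G (A i)) (λ i j → t j ∈? ∂ G (A i)) arc outdegree
  where
  A = lookup L
  a : ∀ i → InRs G k s (A i)
  a i = All.lookup members (∈-lookup i)
  t = λ i → target G k s (a i)
  arc : ∀ {i j} → i ≢ j → t j ∈ ∂ G (A i) ⊎ t i ∈ ∂ G (A j)
  arc i≢j = target∈∂⊎target∈∂ G k s (a _) (a _) (Unique⇒lookup-injective unique i≢j)
  t-injective : Injective _≡_ _≡_ t
  t-injective {i} {j} ti≡tj with i ≟ j
  ... | yes i≡j = i≡j
  ... | no  i≢j = contradiction ti≡tj
                    (targets-distinct G k s (a i) (a j) (Unique⇒lookup-injective unique i≢j))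
  outdegree : ∀ i → ∑[ j < length L ] 𝟙 (t j ∈? ∂ G (A i)) ≤ k
  outdegree i = ≤-trans (injective⇒∑𝟙∈≤∣p∣ t t-injective (∂ G (A i))) (∣∂∣≤k G k s (a i))
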